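{- Let $(X,\otimes)$ be a semigroup, and consider an instance of the off-line range-sum problem (ORSP): a sequence $(a_1,\dots,a_m)\in X^m$ and pairs $(l_1,r_1),\dots,(l_m,r_m)$ with $1\le l_i\le r_i\le m$, where the required output is $(q_1,\dots,q_m)$ with $q_i=a_{l_i}\otimes a_{l_i+1}\otimes\cdots\otimes a_{r_i}$. Over the alphabet $\{x_1,\dots,x_m,\$_1,\dots,\$_{m+1}\}$ of $2m+1$ distinct characters, define $Q_i=x_{l_i}x_{l_i+1}\cdots x_{r_i}$ and $$T=x_1\cdots x_m\,\$_1 Q_1\,\$_2 Q_2\,\$_3\cdots \$_m Q_m\,\$_{m+1}.$$ If there exists a CFG of size $g'$ generating $T$, then the output $(q_1,\dots,q_m)$ of the ORSP can be computed using $O(g')$ semigroup operations.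
   Context: A CFG generating a single string has one rule per nonterminal and an acyclic derivation; its size is the total number of symbols on all right-hand sides. Character $x_j$ corresponds to the semigroup element $a_j$. -}

module Defs where

open import Level using (Level)
open import Data.Nat using (ℕ; zero; suc; _+_)
open import Data.Fin as Fin using (Fin; zero; suc; inject₁; fromℕ)
open import Data.List using (List; []; _∷_; _++_; map; filter; length; concatMap)
open import Data.Nat.ListAction using (sum)
open import Data.List.Membership.Propositional using (_∈_)
open import Data.Product using (_×_; _,_)
open import Data.Sum using (_⊎_)
open import Relation.Nullary.Decidable using (_×-dec_)
open import Induction.WellFounded using (WellFounded)
open import Algebra.Bundles using (Semigroup)

-- Positions (0-based): index j : Fin m stands for the paper's index j+1.

rangeTail : {m : ℕ} → Fin m → Fin m → List (Fin m)
rangeTail {m} l r =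
  filter (λ j → (l Fin.<? j) ×-dec (j Fin.≤? r)) (Data.List.allFin m)

data Char (m : ℕ) : Set where
  x   : Fin m → Char m
  dol : Fin (suc m) → Char m

Qstr : {m : ℕ} → Fin m → Fin m → List (Char m)
Qstr l r = x l ∷ map x (rangeTail l r)

Tstr : (m : ℕ) → (l r : Fin m → Fin m) → List (Char m)
Tstr m l r =
  map x (Data.List.allFin m)
  ++ concatMap (λ i → dol (inject₁ i) ∷ Qstr (l i) (r i)) (Data.List.allFin m)
  ++ (dol (fromℕ m) ∷ [])

data Sym (Σ : Set) (n : ℕ) : Set where
  t  : Σ → Sym Σ n
  nt : Fin n → Sym Σ n

record CFG (Σ : Set) : Set where
  field
    n     : ℕ
    rules : Fin n → List (Sym Σ n)
    start : Fin n

open CFG public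

Occurs : {Σ : Set} (G : CFG Σ) → Fin (n G) → Fin (n G) → Set
Occurs G B A = nt B ∈ rules G A

-- acyclic derivation: the occurrence relation has no infinite descending chain
-- (for a finite set of nonterminals this is exactly acyclicity)
Acyclic : {Σ : Set} → CFG Σ → Set
Acyclic G = WellFounded (Occurs G)

size : {Σ : Set} → CFG Σ → ℕ
size G = sum (map (λ A → length (rules G A)) (Data.List.allFin (n G)))

mutual
  data DerivesSym {Σ : Set} (G : CFG Σ) : Sym Σ (n G) → List Σ → Set where
    term    : ∀ {c} → DerivesSym G (t c) (c ∷ [])
    nonterm : ∀ {A w} → DerivesSeq G (rules G A) w → DerivesSym G (nt A) w

  data DerivesSeq {Σ : Set} (G : CFG Σ) : List (Sym Σ (n G)) → List Σ → Set where
    []  : DerivesSeq G [] []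
    _∷_ : ∀ {s ss u v} → DerivesSym G s u → DerivesSeq G ss v → DerivesSeq G (s ∷ ss) (u ++ v)

Generates : {Σ : Set} → CFG Σ → List Σ → Set
Generates G w = DerivesSym G (nt (start G)) w

-- Straight-line programs over a semigroup (the "semigroup operations" model).
-- A program with k instructions over m inputs; registers are Fin (k + m):
-- register 0 is the most recently computed value, the last m registers are the inputs.

data SLP (m : ℕ) : ℕ → Set where
  []  : SLP m 0
  _▷_ : ∀ {k} → SLP m k → Fin (k + m) × Fin (k + m) → SLP m (suc k)

module _ {a ℓ : Level} (S : Semigroup a ℓ) where
  open Semigroup S

  regs : {m k : ℕ} → (Fin m → Carrier) → SLP m k → Fin (k + m) → Carrier
  regs xs [] j = xs j
  regs xs (p ▷ (i , j)) zero    = regs xs p i ∙ regs xs p j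
  regs xs (p ▷ (i , j)) (suc r) = regs xs p r

  prod : Carrier → List Carrier → Carrier
  prod y []       = y
  prod y (z ∷ zs) = y ∙ prod z zs

  rangeProd : {m : ℕ} → (Fin m → Carrier) → Fin m → Fin m → Carrier
  rangeProd as l r = prod (as l) (map as (rangeTail l r))

{-# OPTIONS --safe #-}
-- Cut a string at its $-signs into a prefix, the inner factors between consecutive $'s,
-- and a suffix. Cutting turns concatenation into a simple operation on such shapes, and the
-- inner factors of T are exactly Q₁, …, Qₘ. Bottom-up over the grammar DAG, each nonterminal
-- is summarized by registers holding the products of the prefix and the suffix of the string
-- it derives, with every inner factor of that string already computed in some register.
-- Appending one summary to another costs at most one multiplication (suffix times the next
-- prefix), so a rule of length L costs at most L multiplications, and since each nonterminal
-- is summarized only once the program has at most size G instructions.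
module Submission where

open import Defs
open import Level using (Level)
open import Algebra.Bundles using (Semigroup)
open import Data.Nat using (ℕ; zero; suc; _+_; _*_; _≤_; z≤n)
open import Data.Nat.Properties
  using (≤-refl; ≤-trans; ≤-reflexive; +-mono-≤; +-monoʳ-≤; +-assoc; n≤1+n; *-identityˡ;
         +-0-commutativeMonoid)
open import Data.Fin as Fin using (Fin; zero; suc; _↑ʳ_; punchIn)
open import Data.Fin.Properties using (_≟_; punchInᵢ≢i)
open import Data.List as List using (List; []; _∷_; _++_; allFin; tabulate; concatMap)
open import Data.List.Properties using (++-assoc; ++-identityʳ; map-tabulate; ∷-injective)
open import Data.List.NonEmpty as List⁺ using (List⁺; _∷_; toList; _⁺++⁺_)
open import Data.List.NonEmpty.Properties using (map-⁺++⁺)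
open import Data.List.Relation.Unary.All as All using (All; []; _∷_)
open import Data.List.Relation.Unary.All.Properties using (++⁺; map⁻)
open import Data.List.Relation.Unary.Any using (here; there)
open import Data.List.Membership.Propositional using (_∈_)
open import Data.List.Membership.Propositional.Properties using (∈-allFin)
open import Data.Maybe using (Maybe; just; nothing; Is-just; to-witness)
import Data.Maybe as Maybe
open import Data.Maybe.Relation.Unary.Any using (just)
open import Data.Product using (Σ; ∃-syntax; _×_; _,_; proj₁; proj₂)
open import Data.Unit using (tt)
import Data.Nat.ListAction as ListSum
open import Algebra.Properties.CommutativeMonoid.Sum +-0-commutativeMonoid
  using (sum; sum-remove; sum-cong-≗)
open import Induction.WellFounded using (Acc; acc)
open import Function using (_∘_)
open import Relation.Nullary using (yes; no; contradiction)
open import Relation.Binary.PropositionalEquality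
  using (_≡_; _≢_; refl; sym; trans; cong; cong₂; subst; module ≡-Reasoning)

factors : ∀ {m k} → SLP m k → Fin (k + m) → List⁺ (Fin m)
factors []            j       = List⁺.[ j ]
factors (P ▷ (i , j)) zero    = factors P i ⁺++⁺ factors P j
factors (P ▷ _)       (suc r) = factors P r

factors-↑ʳ : ∀ {m k} (P : SLP m k) c → factors P (k ↑ʳ c) ≡ List⁺.[ c ]
factors-↑ʳ []      c = refl
factors-↑ʳ (P ▷ _) c = factors-↑ʳ P c

module _ {a ℓ : Level} (S : Semigroup a ℓ) where
  open Semigroup S using (Carrier; _≈_; _∙_; ∙-cong; ∙-congˡ; assoc; setoid)
    renaming (refl to ≈-refl; sym to ≈-sym; trans to ≈-trans)

  prod⁺ : List⁺ Carrier → Carrier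
  prod⁺ (y ∷ ys) = prod S y ys

  prod-++ : ∀ y ys z zs → prod S y (ys ++ z ∷ zs) ≈ prod S y ys ∙ prod S z zs
  prod-++ y []        z zs = ≈-refl
  prod-++ y (y′ ∷ ys) z zs = ≈-trans (∙-congˡ (prod-++ y′ ys z zs)) (≈-sym (assoc y _ _))

  prod⁺-⁺++⁺ : ∀ ys zs → prod⁺ (ys ⁺++⁺ zs) ≈ prod⁺ ys ∙ prod⁺ zs
  prod⁺-⁺++⁺ (y ∷ ys) (z ∷ zs) = prod-++ y ys z zs

  regs≈prod⁺ : ∀ {m k} as (P : SLP m k) r → regs S as P r ≈ prod⁺ (List⁺.map as (factors P r))
  regs≈prod⁺ as []            j       = ≈-refl
  regs≈prod⁺ as (P ▷ (i , j)) zero    = begin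
    regs S as P i ∙ regs S as P j
      ≈⟨ ∙-cong (regs≈prod⁺ as P i) (regs≈prod⁺ as P j) ⟩
    prod⁺ (List⁺.map as (factors P i)) ∙ prod⁺ (List⁺.map as (factors P j))
      ≈⟨ prod⁺-⁺++⁺ (List⁺.map as (factors P i)) (List⁺.map as (factors P j)) ⟨
    prod⁺ (List⁺.map as (factors P i) ⁺++⁺ List⁺.map as (factors P j))
      ≡⟨ cong prod⁺ (map-⁺++⁺ as (factors P i) (factors P j)) ⟨
    prod⁺ (List⁺.map as (factors P i ⁺++⁺ factors P j))
      ∎
    where open import Relation.Binary.Reasoning.Setoid setoid
  regs≈prod⁺ as (P ▷ _)       (suc r) = regs≈prod⁺ as P r

  regs≈prod : ∀ {m k} as (P : SLP m k) r {h tl} →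
              toList (factors P r) ≡ h ∷ tl → regs S as P r ≈ prod S (as h) (List.map as tl)
  regs≈prod as P r eq with ∷-injective eq
  ... | refl , refl = regs≈prod⁺ as P r

Word : ℕ → Set
Word m = List (Fin m)

-- A string over Char m cut at its $-signs: the x-indices before the first $, between
-- consecutive $'s (the inner factors), and after the last $.
data Shape (m : ℕ) : Set where
  plain   : Word m → Shape m
  dollars : Word m → List (Word m) → Word m → Shape m

module _ {m : ℕ} where

  infixr 5 _⊕_
  _⊕_ : Shape m → Shape m → Shape m
  plain u            ⊕ plain v               = plain (u ++ v)
  plain u            ⊕ dollars pre gs suf    = dollars (u ++ pre) gs suf
  dollars pre gs suf ⊕ plain v               = dollars pre gs (suf ++ v)
  dollars pre gs suf ⊕ dollars pre′ gs′ suf′ = dollars pre (gs ++ (suf ++ pre′) ∷ gs′) suf′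

  ⊕-identityˡ : ∀ σ → plain [] ⊕ σ ≡ σ
  ⊕-identityˡ (plain _)       = refl
  ⊕-identityˡ (dollars _ _ _) = refl

  letter : Char m → Shape m
  letter (x c)   = plain (c ∷ [])
  letter (dol _) = dollars [] [] []

  letter-⊕-assoc : ∀ c σ τ → letter c ⊕ (σ ⊕ τ) ≡ (letter c ⊕ σ) ⊕ τ
  letter-⊕-assoc (x _)   (plain _)       (plain _)       = refl
  letter-⊕-assoc (x _)   (plain _)       (dollars _ _ _) = refl
  letter-⊕-assoc (x _)   (dollars _ _ _) (plain _)       = refl
  letter-⊕-assoc (x _)   (dollars _ _ _) (dollars _ _ _) = refl
  letter-⊕-assoc (dol _) (plain _)       (plain _)       = refl
  letter-⊕-assoc (dol _) (plain _)       (dollars _ _ _) = refl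
  letter-⊕-assoc (dol _) (dollars _ _ _) (plain _)       = refl
  letter-⊕-assoc (dol _) (dollars _ _ _) (dollars _ _ _) = refl

  shape : List (Char m) → Shape m
  shape []      = plain []
  shape (c ∷ u) = letter c ⊕ shape u

  shape-++ : ∀ u v → shape (u ++ v) ≡ shape u ⊕ shape v
  shape-++ []      v = sym (⊕-identityˡ (shape v))
  shape-++ (c ∷ u) v =
    trans (cong (letter c ⊕_) (shape-++ u v)) (letter-⊕-assoc c (shape u) (shape v))

  shape-map-x : ∀ w → shape (List.map x w) ≡ plain w
  shape-map-x []      = refl
  shape-map-x (c ∷ w) = cong (letter (x c) ⊕_) (shape-map-x w)

  innerFactors : Shape m → List (Word m)
  innerFactors (plain _)        = []
  innerFactors (dollars _ gs _) = gs

module _ {m : ℕ} (l r : Fin m → Fin m) where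

  Qword : Fin m → Word m
  Qword i = l i ∷ rangeTail (l i) (r i)

  shape-queries : ∀ is z →
    shape (concatMap (λ i → dol (Fin.inject₁ i) ∷ Qstr (l i) (r i)) is ++ dol z ∷ [])
      ≡ dollars [] (List.map Qword is) []
  shape-queries []       z = refl
  shape-queries (i ∷ is) z = begin
    shape ((dol (Fin.inject₁ i) ∷ Qstr (l i) (r i) ++ queries) ++ dol z ∷ [])
      ≡⟨ cong shape (++-assoc (dol (Fin.inject₁ i) ∷ Qstr (l i) (r i)) queries (dol z ∷ [])) ⟩
    letter (dol (Fin.inject₁ i)) ⊕ shape (List.map x (Qword i) ++ queries ++ dol z ∷ [])
      ≡⟨ cong (letter (dol (Fin.inject₁ i)) ⊕_) (shape-++ (List.map x (Qword i)) _) ⟩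
    letter (dol (Fin.inject₁ i)) ⊕ shape (List.map x (Qword i)) ⊕ shape (queries ++ dol z ∷ [])
      ≡⟨ cong₂ (λ σ τ → letter (dol (Fin.inject₁ i)) ⊕ σ ⊕ τ) (shape-map-x (Qword i)) (shape-queries is z) ⟩
    dollars [] ((Qword i ++ []) ∷ List.map Qword is) []
      ≡⟨ cong (λ w → dollars [] (w ∷ List.map Qword is) []) (++-identityʳ (Qword i)) ⟩
    dollars [] (Qword i ∷ List.map Qword is) []
      ∎
    where
    open ≡-Reasoning
    queries = concatMap (λ i → dol (Fin.inject₁ i) ∷ Qstr (l i) (r i)) is

  innerFactors-T : innerFactors (shape (Tstr m l r)) ≡ List.map Qword (allFin m)
  innerFactors-T = cong innerFactors (begin
    shape (List.map x (allFin m) ++ queries)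
      ≡⟨ shape-++ (List.map x (allFin m)) queries ⟩
    shape (List.map x (allFin m)) ⊕ shape queries
      ≡⟨ cong₂ _⊕_ (shape-map-x (allFin m)) (shape-queries (allFin m) (Fin.fromℕ m)) ⟩
    dollars (allFin m ++ []) (List.map Qword (allFin m)) []
      ∎)
    where
    open ≡-Reasoning
    queries = concatMap (λ i → dol (Fin.inject₁ i) ∷ Qstr (l i) (r i)) (allFin m)
              ++ dol (Fin.fromℕ m) ∷ []

record Prog (m : ℕ) : Set where
  constructor prog
  field
    {steps} : ℕ
    code    : SLP m steps
open Prog

module _ {m : ℕ} where

  Reg : Prog m → Set
  Reg p = Fin (steps p + m)

  word : (p : Prog m) → Reg p → Word m
  word p r = toList (factors (code p) r)

  infix 4 _⊑_
  data _⊑_ (p : Prog m) : Prog m → Set where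
    ⊑-refl : p ⊑ p
    ⊑-step : ∀ {k} {P : SLP m k} {ij} → p ⊑ prog P → p ⊑ prog (P ▷ ij)

  ⊑-trans : ∀ {p q s} → p ⊑ q → q ⊑ s → p ⊑ s
  ⊑-trans e ⊑-refl      = e
  ⊑-trans e (⊑-step e′) = ⊑-step (⊑-trans e e′)

  wkReg : ∀ {p q} → p ⊑ q → Reg p → Reg q
  wkReg ⊑-refl     r = r
  wkReg (⊑-step e) r = suc (wkReg e r)

  word-wkReg : ∀ {p q} (e : p ⊑ q) r → word q (wkReg e r) ≡ word p r
  word-wkReg ⊑-refl     r = refl
  word-wkReg (⊑-step e) r = word-wkReg e r

  -- A semigroup has no empty product, so the empty word is held by no register.
  data Value (p : Prog m) : Word m → Set where
    ε        : Value p []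
    computed : ∀ {w} (r : Reg p) → word p r ≡ w → Value p w

  wkValue : ∀ {p q w} → p ⊑ q → Value p w → Value q w
  wkValue e ε               = ε
  wkValue e (computed r eq) = computed (wkReg e r) (trans (word-wkReg e r) eq)

  Value-∷ : ∀ {p h tl} → Value p (h ∷ tl) → Σ (Reg p) λ r → word p r ≡ h ∷ tl
  Value-∷ (computed r eq) = r , eq

  data Summary (p : Prog m) : Shape m → Set where
    plain   : ∀ {w} → Value p w → Summary p (plain w)
    dollars : ∀ {pre gs suf} →
              Value p pre → All (Value p) gs → Value p suf → Summary p (dollars pre gs suf)

  wkSummary : ∀ {p q σ} → p ⊑ q → Summary p σ → Summary q σ
  wkSummary e (plain v)        = plain (wkValue e v)
  wkSummary e (dollars u vs w) = dollars (wkValue e u) (All.map (wkValue e) vs) (wkValue e w)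

  innerValues : ∀ {p σ} → Summary p σ → All (Value p) (innerFactors σ)
  innerValues (plain _)        = []
  innerValues (dollars _ vs _) = vs

  record Extension (p : Prog m) (n : ℕ) (F : Prog m → Set) : Set where
    constructor extension
    field
      {new}   : Prog m
      extends : p ⊑ new
      bounded : steps new ≤ n + steps p
      value   : F new
  open Extension

  pure : ∀ {p F} → F p → Extension p 0 F
  pure = extension ⊑-refl ≤-refl

  mapExt : ∀ {p n F H} → (∀ {q} → p ⊑ q → F q → H q) → Extension p n F → Extension p n H
  mapExt f (extension e b v) = extension e b (f e v)

  infixl 1 _>>=_
  _>>=_ : ∀ {p n n′ F H} → Extension p n F → (∀ {q} → p ⊑ q → F q → Extension q n′ H) →
          Extension p (n′ + n) H
  _>>=_ {p} {n} {n′} (extension e b v) f =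
    extension (⊑-trans e (extends o)) (≤-trans (bounded o) bound) (value o)
    where
    o = f e v
    bound = ≤-trans (+-monoʳ-≤ n′ b) (≤-reflexive (sym (+-assoc n′ n (steps p))))

  multiply : ∀ {p u v} → Value p u → Value p v → Extension p 1 (λ q → Value q (u ++ v))
  multiply {p} ε b = extension ⊑-refl (n≤1+n (steps p)) b
  multiply {p} {u} a ε =
    extension ⊑-refl (n≤1+n (steps p)) (subst (Value p) (sym (++-identityʳ u)) a)
  multiply {p} (computed i refl) (computed j refl) =
    extension (⊑-step ⊑-refl) ≤-refl (computed zero refl)

  -- The suffix of the left summary meets the prefix of the right one; their product is
  -- the one new multiplication, and becomes an inner factor when both sides contain a $.
  combine : ∀ {p σ τ} → Summary p σ → Summary p τ → Extension p 1 (λ q → Summary q (σ ⊕ τ))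
  combine (plain a)        (plain b)        = mapExt (λ _ → plain) (multiply a b)
  combine (plain a)        (dollars b ws c) =
    mapExt (λ e ab → dollars ab (All.map (wkValue e) ws) (wkValue e c)) (multiply a b)
  combine (dollars a vs b) (plain c)        =
    mapExt (λ e bc → dollars (wkValue e a) (All.map (wkValue e) vs) bc) (multiply b c)
  combine (dollars a vs b) (dollars c ws d) =
    mapExt (λ e bc → dollars (wkValue e a)
                             (++⁺ (All.map (wkValue e) vs) (bc ∷ All.map (wkValue e) ws))
                             (wkValue e d))
           (multiply b c)

sum-mono-≤ : ∀ {n} {f g : Fin n → ℕ} → (∀ i → f i ≤ g i) → sum f ≤ sum g
sum-mono-≤ {zero}  _   = z≤n
sum-mono-≤ {suc n} f≤g = +-mono-≤ (f≤g zero) (sum-mono-≤ (f≤g ∘ suc))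

sum-insert : ∀ {n} (f g : Fin n → ℕ) A → f A ≡ 0 → (∀ B → B ≢ A → g B ≡ f B) →
             sum g ≡ g A + sum f
sum-insert {suc n} f g A fA≡0 g≡f = begin
  sum g                                ≡⟨ sum-remove g ⟩
  g A + sum (g ∘ punchIn A)            ≡⟨ cong (g A +_) (sum-cong-≗ (λ j → g≡f (punchIn A j) (punchInᵢ≢i A j))) ⟩
  g A + sum (f ∘ punchIn A)            ≡⟨ cong (λ z → g A + (z + sum (f ∘ punchIn A))) fA≡0 ⟨
  g A + (f A + sum (f ∘ punchIn A))    ≡⟨ cong (g A +_) (sum-remove f) ⟨
  g A + sum f                          ∎
  where open ≡-Reasoning

sum-tabulate : ∀ {n} (f : Fin n → ℕ) → ListSum.sum (tabulate f) ≡ sum f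
sum-tabulate {zero}  f = refl
sum-tabulate {suc n} f = cong (f zero +_) (sum-tabulate (f ∘ suc))

sum-map-allFin : ∀ {n} (f : Fin n → ℕ) → ListSum.sum (List.map f (allFin n)) ≡ sum f
sum-map-allFin f = trans (cong ListSum.sum (map-tabulate (λ i → i) f)) (sum-tabulate f)

Is-just-map : ∀ {X Y : Set} (f : X → Y) {mx} → Is-just mx → Is-just (Maybe.map f mx)
Is-just-map f (just _) = just tt

module _ {n : ℕ} {E : Fin n → Set} where

  infix 6 _[_]≔_
  _[_]≔_ : (∀ B → Maybe (E B)) → (A : Fin n) → E A → ∀ B → Maybe (E B)
  (tbl [ A ]≔ e) B with B ≟ A
  ... | yes refl = just e
  ... | no _     = tbl B

  []≔-same : ∀ tbl A e → (tbl [ A ]≔ e) A ≡ just e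
  []≔-same tbl A e with A ≟ A
  ... | yes refl = refl
  ... | no A≢A   = contradiction refl A≢A

  []≔-other : ∀ tbl {A B} e → B ≢ A → (tbl [ A ]≔ e) B ≡ tbl B
  []≔-other tbl {A} {B} e B≢A with B ≟ A
  ... | yes B≡A = contradiction B≡A B≢A
  ... | no _    = refl

  []≔-Is-just : ∀ tbl A e {B} → Is-just (tbl B) → Is-just ((tbl [ A ]≔ e) B)
  []≔-Is-just tbl A e {B} d with B ≟ A
  ... | yes refl = just tt
  ... | no _     = d

module Memoization {m : ℕ} (G : CFG (Char m)) where

  Symbol : Set
  Symbol = Sym (Char m) (n G)

  record Summarized (p : Prog m) (D : List (Char m) → Set) : Set where
    constructor summarized
    field
      {σ}     : Shape m
      shape≡  : ∀ {u} → D u → shape u ≡ σ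
      summary : Summary p σ
  open Summarized public

  wkSummarized : ∀ {p q D} → p ⊑ q → Summarized p D → Summarized q D
  wkSummarized e (summarized eq s) = summarized eq (wkSummary e s)

  Entry : Prog m → Fin (n G) → Set
  Entry p A = Summarized p (DerivesSym G (nt A))

  summarizeTerminal : ∀ {p} c → Summarized p (DerivesSym G (t c))
  summarizeTerminal {p} (x c) =
    summarized (λ { term → refl })
               (plain (computed (steps p ↑ʳ c) (cong toList (factors-↑ʳ (code p) c))))
  summarizeTerminal (dol _) = summarized (λ { term → refl }) (dollars ε [] ε)

  shape-∷ : ∀ {s ss σ τ} →
            (∀ {u} → DerivesSym G s u → shape u ≡ σ) → (∀ {v} → DerivesSeq G ss v → shape v ≡ τ) →
            ∀ {w} → DerivesSeq G (s ∷ ss) w → shape w ≡ σ ⊕ τ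
  shape-∷ f g (_∷_ {u = u} {v = v} d ds) = trans (shape-++ u v) (cong₂ _⊕_ (f d) (g ds))

  consSummarized : ∀ {p s ss} → Summarized p (DerivesSym G s) → Summarized p (DerivesSeq G ss) →
                   Extension p 1 (λ q → Summarized q (DerivesSeq G (s ∷ ss)))
  consSummarized (summarized f a) (summarized g b) =
    mapExt (λ _ → summarized (shape-∷ f g)) (combine a b)

  summarizeSymbols : ∀ {p} (ss : List Symbol) → (∀ {B} → nt B ∈ ss → Entry p B) →
                     Extension p (List.length ss) (λ q → Summarized q (DerivesSeq G ss))
  summarizeSymbols []          _       = pure (summarized (λ { [] → refl }) (plain ε))
  summarizeSymbols (t c ∷ ss)  entries =
    summarizeSymbols ss (λ B∈ss → entries (there B∈ss)) >>= λ _ rest →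
    consSummarized (summarizeTerminal c) rest
  summarizeSymbols (nt B ∷ ss) entries =
    summarizeSymbols ss (λ B∈ss → entries (there B∈ss)) >>= λ e rest →
    consSummarized (wkSummarized e (entries (here refl))) rest

  ruleEntry : ∀ {p A} → Summarized p (DerivesSeq G (rules G A)) → Entry p A
  ruleEntry (summarized f a) = summarized (λ { (nonterm d) → f d }) a

  Table : Prog m → Set
  Table p = (A : Fin (n G)) → Maybe (Entry p A)

  wkTable : ∀ {p q} → p ⊑ q → Table p → Table q
  wkTable e tbl A = Maybe.map (wkSummarized e) (tbl A)

  charge : ∀ {X : Set} → Fin (n G) → Maybe X → ℕ
  charge A nothing  = 0
  charge A (just _) = List.length (rules G A)

  charge-map : ∀ {X Y : Set} (f : X → Y) A mx → charge A (Maybe.map f mx) ≡ charge A mx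
  charge-map f A nothing  = refl
  charge-map f A (just _) = refl

  charge≤length : ∀ {X : Set} A (mx : Maybe X) → charge A mx ≤ List.length (rules G A)
  charge≤length A nothing  = z≤n
  charge≤length A (just _) = ≤-refl

  cost : ∀ {p} → Table p → Fin (n G) → ℕ
  cost tbl A = charge A (tbl A)

  record Memo : Set where
    constructor memo
    field
      {program} : Prog m
      table     : Table program
      paid      : steps program ≤ sum (cost table)
  open Memo public

  Done : Memo → Fin (n G) → Set
  Done s A = Is-just (table s A)

  infix 4 _≼_
  _≼_ : Memo → Memo → Set
  s ≼ s′ = ∀ {B} → Done s B → Done s′ B

  Progress : Memo → (Memo → Set) → Set
  Progress s P = Σ Memo λ s′ → s ≼ s′ × P s′

  enter : (s : Memo) (A : Fin (n G)) → table s A ≡ nothing →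
          (∀ {B} → nt B ∈ rules G A → Done s B) → Progress s (λ s′ → Done s′ A)
  enter (memo tbl paid-tbl) A absent children =
    memo tbl′ paid-tbl′ , ([]≔-Is-just tblʷ A entryA ∘ Is-just-map _) ,
    subst Is-just (sym ([]≔-same tblʷ A entryA)) (just tt)
    where
    o = summarizeSymbols (rules G A) (λ B∈rule → to-witness (children B∈rule))
    tblʷ = wkTable (Extension.extends o) tbl
    entryA = ruleEntry (Extension.value o)
    tbl′ = tblʷ [ A ]≔ entryA
    unchanged : ∀ B → B ≢ A → cost tbl′ B ≡ cost tbl B
    unchanged B B≢A = trans (cong (charge B) ([]≔-other tblʷ entryA B≢A)) (charge-map _ B (tbl B))
    sum-tbl′ : sum (cost tbl′) ≡ List.length (rules G A) + sum (cost tbl)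
    sum-tbl′ = trans (sum-insert (cost tbl) (cost tbl′) A (cong (charge A) absent) unchanged)
                     (cong (λ mx → charge A mx + sum (cost tbl)) ([]≔-same tblʷ A entryA))
    paid-tbl′ : steps (Extension.new o) ≤ sum (cost tbl′)
    paid-tbl′ = ≤-trans (Extension.bounded o)
                  (≤-trans (+-monoʳ-≤ (List.length (rules G A)) paid-tbl) (≤-reflexive (sym sum-tbl′)))

  visitAll : (ss : List Symbol) → (∀ {B} → nt B ∈ ss → ∀ s → Progress s (λ s′ → Done s′ B)) →
             ∀ s → Progress s (λ s′ → ∀ {B} → nt B ∈ ss → Done s′ B)
  visitAll []          _     s = s , (λ d → d) , λ ()
  visitAll (t _ ∷ ss)  visit s with visitAll ss (λ B∈ss → visit (there B∈ss)) s
  ... | s′ , s≼s′ , done = s′ , s≼s′ , λ { (there B∈ss) → done B∈ss }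
  visitAll (nt B ∷ ss) visit s with visit (here refl) s
  ... | s₁ , s≼s₁ , doneB with visitAll ss (λ B∈ss → visit (there B∈ss)) s₁
  ... | s₂ , s₁≼s₂ , done =
    s₂ , (λ d → s₁≼s₂ (s≼s₁ d)) ,
    λ { (here refl) → s₁≼s₂ doneB ; (there B∈ss) → done B∈ss }

  visit : ∀ A → Acc (Occurs G) A → ∀ s → Progress s (λ s′ → Done s′ A)
  visit A (acc rec) s with visitAll (rules G A) (λ {B} B∈rule → visit B (rec B∈rule)) s
  ... | s₁ , s≼s₁ , children with table s₁ A in eq
  ... | just _  = s₁ , s≼s₁ , subst Is-just (sym eq) (just tt)
  ... | nothing with enter s₁ A eq children
  ... | s₂ , s₁≼s₂ , doneA = s₂ , (λ d → s₁≼s₂ (s≼s₁ d)) , doneA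

  cost≤size : ∀ {p} (tbl : Table p) → sum (cost tbl) ≤ size G
  cost≤size tbl = ≤-trans (sum-mono-≤ (λ A → charge≤length A (tbl A)))
                          (≤-reflexive (sym (sum-map-allFin (λ A → List.length (rules G A)))))

  empty : Memo
  empty = memo {prog []} (λ _ → nothing) z≤n

module _ {a ℓ : Level} {m : ℕ} (l r : Fin m → Fin m) (G : CFG (Char m)) where

  rangeProgram : Acyclic G → Generates G (Tstr m l r) →
    Σ ℕ λ k → Σ (SLP m k) λ P → Σ (Fin m → Fin (k + m)) λ out →
      k ≤ size G
      × ((S : Semigroup a ℓ) (as : Fin m → Semigroup.Carrier S) (i : Fin m) →
         Semigroup._≈_ S (regs S as P (out i)) (rangeProd S as (l i) (r i)))
  rangeProgram acyclic generates =
    steps p , code p , (λ i → proj₁ (query i)) , ≤-trans (paid s) (cost≤size (table s)) ,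
    λ S as i → regs≈prod S as (code p) (proj₁ (query i)) (proj₂ (query i))
    where
    open Memoization G
    visited = visit (start G) (acyclic (start G)) empty
    s = proj₁ visited
    p = program s
    root = to-witness (proj₂ (proj₂ visited))
    queries : All (Value p) (List.map (Qword l r) (allFin m))
    queries = subst (All (Value p)) (trans (cong innerFactors (sym (shape≡ root generates)))
                                            (innerFactors-T l r))
                    (innerValues (summary root))
    query : ∀ i → Σ (Reg p) λ reg → word p reg ≡ Qword l r i
    query i = Value-∷ (All.lookup (map⁻ queries) (∈-allFin i))

mainTheorem3 : {a ℓ : Level} →
    ∃[ c ] ((m : ℕ) (l r : Fin m → Fin m) → (∀ i → l i Fin.≤ r i) →
      (G : CFG (Char m)) → Acyclic G → Generates G (Tstr m l r) →
      Σ ℕ λ k → Σ (SLP m k) λ P → Σ (Fin m → Fin (k + m)) λ out →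
        (k ≤ c * size G)
        × ((S : Semigroup a ℓ) (as : Fin m → Semigroup.Carrier S) (i : Fin m) →
           Semigroup._≈_ S (regs S as P (out i)) (rangeProd S as (l i) (r i))))
mainTheorem3 = 1 , λ m l r _ G acyclic generates →
  let k , P , out , k≤size , correct = rangeProgram l r G acyclic generates
  in k , P , out , ≤-trans k≤size (≤-reflexive (sym (*-identityˡ (size G)))) , correct
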